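{- For every integer $n \ge 5$, $\mathrm{eqdim}(T_n)=2n$.
   Context: All graphs are finite, simple, connected and undirected; $d(u,v)$ denotes the number of edges of a shortest path between $u$ and $v$. A vertex $x$ is equidistant from $u$ and $v$ if $d(u,x)=d(v,x)$. A set $S\subseteq V(G)$ is a distance-equalizer set of $G$ if for every pair of distinct vertices $u,v\in V(G)\setminus S$ there is $x\in S$ equidistant from $u$ and $v$. The equidistant dimension $\mathrm{eqdim}(G)$ is the minimum cardinality of a distance-equalizer set of $G$. The graph $T_n$ has vertex set $\{a_i,b_i,c_i,d_i : i=0,\dots,n-1\}$ and edge set $\{a_ia_{i+1}, b_ib_{i+1}, c_ic_{i+1}, d_id_{i+1}, a_ib_i, b_ic_i, c_id_i, a_{i+1}b_i, c_id_{i+1} : i=0,\dots,n-1\}$, with indices taken modulo $n$. -}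

module Defs where

open import Data.Nat using (ℕ; zero; suc; _≤_; _<_)
open import Data.Fin using (Fin; toℕ)
open import Data.Product using (_×_; ∃; ∃-syntax; _,_)
open import Data.Sum using (_⊎_)
open import Data.List using (List; length)
open import Data.List.Membership.Propositional using (_∈_; _∉_)
open import Data.List.Relation.Unary.Unique.Propositional using (Unique)
open import Relation.Binary.PropositionalEquality using (_≡_; _≢_)
open import Relation.Nullary using (¬_)

data Walk {V : Set} (Adj : V → V → Set) : V → V → ℕ → Set where
  nil  : ∀ {u} → Walk Adj u u zero
  cons : ∀ {u w v k} → Adj u w → Walk Adj w v k → Walk Adj u v (suc k)

Dist : {V : Set} (Adj : V → V → Set) → V → V → ℕ → Set
Dist Adj u v k = Walk Adj u v k × (∀ m → m < k → ¬ Walk Adj u v m)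

Equidistant : {V : Set} (Adj : V → V → Set) → V → V → V → Set
Equidistant Adj x u v = ∃[ k ] (Dist Adj u x k × Dist Adj v x k)

IsDistanceEqualizer : {V : Set} (Adj : V → V → Set) → List V → Set
IsDistanceEqualizer {V} Adj S =
  ∀ (u v : V) → u ≢ v → u ∉ S → v ∉ S →
  ∃[ x ] (x ∈ S × Equidistant Adj x u v)

-- eqdim(G) = k : k is the minimum cardinality of a distance-equalizer set
-- (sets are represented by duplicate-free lists; cardinality = length)
EqDimIs : {V : Set} (Adj : V → V → Set) → ℕ → Set
EqDimIs {V} Adj k =
  (∃[ S ] (Unique S × length S ≡ k × IsDistanceEqualizer Adj S))
  × (∀ (S : List V) → Unique S → IsDistanceEqualizer Adj S → k ≤ length S)

data Layer : Set where
  A B C D : Layer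

-- vertex (l , i) stands for l_i, e.g. (A , i) = a_i
TV : ℕ → Set
TV n = Layer × Fin n

Next : (n : ℕ) → Fin n → Fin n → Set
Next n i j = (suc (toℕ i) ≡ toℕ j) ⊎ (suc (toℕ i) ≡ n × toℕ j ≡ 0)

data TEdge (n : ℕ) : TV n → TV n → Set where
  aa : ∀ {i j} → Next n i j → TEdge n (A , i) (A , j)
  bb : ∀ {i j} → Next n i j → TEdge n (B , i) (B , j)
  cc : ∀ {i j} → Next n i j → TEdge n (C , i) (C , j)
  dd : ∀ {i j} → Next n i j → TEdge n (D , i) (D , j)
  ab : ∀ {i} → TEdge n (A , i) (B , i)
  bc : ∀ {i} → TEdge n (B , i) (C , i)
  cd : ∀ {i} → TEdge n (C , i) (D , i)
  a'b : ∀ {i j} → Next n i j → TEdge n (A , j) (B , i)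
  cd' : ∀ {i j} → Next n i j → TEdge n (C , i) (D , j)

TAdj : (n : ℕ) → TV n → TV n → Set
TAdj n u v = TEdge n u v ⊎ TEdge n v u

-- The a- and b-vertices form a cycle a₀ b₀ a₁ b₁ … of length 2n in which vertices two steps
-- apart are also adjacent; the c- and d-vertices (d₀ c₀ d₁ c₁ …) form a second such cycle,
-- and the rungs bᵢcᵢ join the two. Give every vertex its position on this 2n-cycle and a
-- level (a 0, b 1, c 3, d 4). Every edge changes cyclic position plus level by at most 2, so
-- a walk of length m spans at most 2m, and walks through the b-layer attain this bound.
-- Hence two c/d-vertices are equidistant from the a/b-vertex halfway between them (the
-- adjacent pairs cᵢdᵢ and cᵢdᵢ₊₁ use bᵢ₋₁ and bᵢ₊₁ instead), so the 2n a/b-vertices form a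
-- distance-equalizer set. Conversely, the mirror map aᵢ ↔ dᵢ, bᵢ ↔ cᵢ is an automorphism, and
-- no vertex is equidistant from an a/b-vertex v and its mirror image: a walk from the c/d
-- side to the a/b side has to cross a rung, and mirroring the part before the crossing gives
-- a strictly shorter walk from the other vertex. So every distance-equalizer set meets each
-- of the 2n disjoint pairs {v, mirror v}.
module Submission where

open import Defs
open import Algebra.Properties.CommutativeSemigroup using (x∙yz≈y∙xz; xy∙z≈y∙xz)
open import Data.Nat using (ℕ; zero; suc; _+_; _*_; _≤_; _<_; z≤n; s≤s; _%_; _/_; ∣_-_∣; NonZero)
open import Data.Nat.Properties
open import Data.Nat.DivMod using (%-distribˡ-+; m≡m%n+[m/n]*n; m<n⇒m%n≡m; n%n≡0)
open import Data.Nat.Tactic.RingSolver using (solve-∀)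
open import Data.Fin as Fin using (Fin; toℕ; fromℕ; fromℕ<; inject₁; splitAt; join)
open import Data.Fin.Properties
  using (toℕ-injective; toℕ<n; toℕ-fromℕ; toℕ-fromℕ<; toℕ-inject₁; join-splitAt; splitAt-join)
  using (injective⇒≤)
open import Data.Product using (Σ-syntax; ∃-syntax; _×_; _,_; proj₁; proj₂)
open import Data.Product.Properties using (≡-dec)
open import Data.Sum using (_⊎_; inj₁; inj₂; swap)
open import Data.Empty using (⊥; ⊥-elim)
open import Data.List using (List; map; length; allFin; lookup)
open import Data.List.Properties using (length-map; length-tabulate)
open import Data.List.Membership.Propositional using (_∈_; _∉_)
open import Data.List.Membership.Propositional.Properties using (∈-map⁺; ∈-allFin)
import Data.List.Membership.DecPropositional as DecMembership
import Data.List.Relation.Unary.Any as Any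
open import Data.List.Relation.Unary.Any.Properties using (lookup-index)
open import Data.List.Relation.Unary.Unique.Propositional using (Unique)
open import Data.List.Relation.Unary.Unique.Propositional.Properties using (map⁺; allFin⁺)
open import Function using (id; _∘_)
open import Relation.Binary.Definitions using (DecidableEquality; tri<; tri≈; tri>)
open import Relation.Binary.PropositionalEquality
open import Relation.Nullary using (¬_; yes; no)
open import Relation.Nullary.Decidable using (map′)

module _ {V : Set} {Adj : V → V → Set} where

  snoc : ∀ {u v w m} → Walk Adj u v m → Adj v w → Walk Adj u w (suc m)
  snoc nil        e′ = cons e′ nil
  snoc (cons e p) e′ = cons e (snoc p e′)

  map-walk : (f : V → V) → (∀ {u w} → Adj u w → Adj (f u) (f w)) →
             ∀ {u w m} → Walk Adj u w m → Walk Adj (f u) (f w) m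
  map-walk f hom nil        = nil
  map-walk f hom (cons e p) = cons (hom e) (map-walk f hom p)

  dist-intro : ∀ {u v k} → Walk Adj u v k → (∀ {m} → Walk Adj u v m → k ≤ m) → Dist Adj u v k
  dist-intro p shortest = p , λ m m<k q → <⇒≱ m<k (shortest q)

  module _ (sym-adj : ∀ {u w} → Adj u w → Adj w u) where

    reverse : ∀ {u w m} → Walk Adj u w m → Walk Adj w u m
    reverse nil        = nil
    reverse (cons e p) = snoc (reverse p) (sym-adj e)

    dist-sym : ∀ {u v k} → Dist Adj u v k → Dist Adj v u k
    dist-sym (p , shortest) = reverse p , λ m m<k q → shortest m m<k (reverse q)

Unequalizable : {V : Set} (Adj : V → V → Set) → V → V → Set
Unequalizable Adj u v = u ≢ v × (∀ x → ¬ Equidistant Adj x u v)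

module _ {V : Set} {Adj : V → V → Set} (_≟_ : DecidableEquality V) where
  open DecMembership _≟_ using (_∈?_)

  equalizer-meets : ∀ {S u v} → IsDistanceEqualizer Adj S → Unequalizable Adj u v → u ∈ S ⊎ v ∈ S
  equalizer-meets {S} {u} {v} equalizer (u≢v , unequal) with u ∈? S | v ∈? S
  ... | yes u∈S | _       = inj₁ u∈S
  ... | no _    | yes v∈S = inj₂ v∈S
  ... | no u∉S  | no v∉S  with equalizer u v u≢v u∉S v∉S
  ...   | x , _ , equidistant = ⊥-elim (unequal x equidistant)

  unequalizable-pairs≤length : ∀ {k} (p q : Fin k → V) (owner : V → Fin k) →
    (∀ t → owner (p t) ≡ t) → (∀ t → owner (q t) ≡ t) → (∀ t → Unequalizable Adj (p t) (q t)) →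
    ∀ {S} → IsDistanceEqualizer Adj S → k ≤ length S
  unequalizable-pairs≤length {k} p q owner owner-p owner-q unequal {S} equalizer =
    injective⇒≤ {f = slot} λ {s} {t} eq →
      trans (sym (owner-slot s)) (trans (cong (owner ∘ lookup S) eq) (owner-slot t))
    where
    hit : ∀ t → Σ[ y ∈ V ] y ∈ S × owner y ≡ t
    hit t with equalizer-meets equalizer (unequal t)
    ... | inj₁ p∈S = p t , p∈S , owner-p t
    ... | inj₂ q∈S = q t , q∈S , owner-q t

    slot : Fin k → Fin (length S)
    slot t = Any.index (proj₁ (proj₂ (hit t)))

    owner-slot : ∀ t → owner (lookup S (slot t)) ≡ t
    owner-slot t = trans (cong owner (sym (lookup-index (proj₁ (proj₂ (hit t)))))) (proj₂ (proj₂ (hit t)))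

m+m≤n+n⇒m≤n : ∀ {m n} → m + m ≤ n + n → m ≤ n
m+m≤n+n⇒m≤n m+m≤n+n = ≮⇒≥ λ n<m → <⇒≱ (+-mono-< n<m n<m) m+m≤n+n

double-suc : ∀ m → 2 + (m + m) ≡ suc m + suc m
double-suc m = cong suc (sym (+-suc m m))

odd-halves : ∀ q g → suc (q + (g + g)) ≡ q + g + suc g
odd-halves = solve-∀

even-halves : ∀ q g → suc (suc (q + (g + g))) ≡ q + suc g + suc g
even-halves = solve-∀

balanced-halves-≤ : ∀ {p q r g₁ g₂ i j b} → p ≤ 1 → p + g₁ ≡ r + g₂ →
                    i + (q + g₁ + (r + g₂)) ≡ j → j < b →
                    p + q + (g₁ + g₁) ≤ b × q + r + (g₂ + g₂) ≤ b
balanced-halves-≤ {p} {q} {r} {g₁} {g₂} {i} {j} {b} p≤1 balanced i+span≡j j<b = first , second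
  where
  open ≤-Reasoning

  span : ℕ
  span = q + g₁ + (r + g₂)

  shuffle₁ : ∀ p q g → p + q + (g + g) ≡ q + g + (p + g)
  shuffle₁ = solve-∀
  shuffle₂ : ∀ q r g → q + r + (g + g) + r ≡ q + (r + g) + (r + g)
  shuffle₂ = solve-∀
  shuffle₃ : ∀ p q r g₁ g₂ → q + (r + g₂) + (p + g₁) ≡ p + (q + g₁ + (r + g₂))
  shuffle₃ = solve-∀

  first : p + q + (g₁ + g₁) ≤ b
  first = begin
    p + q + (g₁ + g₁)   ≡⟨ shuffle₁ p q g₁ ⟩
    q + g₁ + (p + g₁)   ≡⟨ cong (q + g₁ +_) balanced ⟩
    span                ≤⟨ m≤n+m span i ⟩
    i + span            ≡⟨ i+span≡j ⟩
    j                   ≤⟨ <⇒≤ j<b ⟩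
    b                   ∎

  second : q + r + (g₂ + g₂) ≤ b
  second = begin
    q + r + (g₂ + g₂)           ≤⟨ m≤m+n _ r ⟩
    q + r + (g₂ + g₂) + r       ≡⟨ shuffle₂ q r g₂ ⟩
    q + (r + g₂) + (r + g₂)     ≡⟨ cong (q + (r + g₂) +_) balanced ⟨
    q + (r + g₂) + (p + g₁)     ≡⟨ shuffle₃ p q r g₁ g₂ ⟩
    p + span                    ≤⟨ +-monoˡ-≤ span p≤1 ⟩
    suc span                    ≤⟨ s≤s (m≤n+m span i) ⟩
    suc (i + span)              ≡⟨ cong suc i+span≡j ⟩
    suc j                       ≤⟨ j<b ⟩
    b                           ∎

module Cyclic (N : ℕ) .⦃ _ : NonZero N ⦄ where

  %-congˡ : ∀ c {a b} → a % N ≡ b % N → (c + a) % N ≡ (c + b) % N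
  %-congˡ c {a} {b} a≡b = begin
    (c + a) % N           ≡⟨ %-distribˡ-+ c a N ⟩
    (c % N + a % N) % N   ≡⟨ cong (λ r → (c % N + r) % N) a≡b ⟩
    (c % N + b % N) % N   ≡⟨ %-distribˡ-+ c b N ⟨
    (c + b) % N           ∎
    where open ≡-Reasoning

  -- On the cycle ℤ/N, h ≤ N/2 is the distance from a to b = a + h, so it bounds t + s
  -- whenever moving a forward by t and b forward by s meet.
  cyclic-gap : ∀ {b} a h t s → (t + a) % N ≡ (s + b) % N → a + h ≡ b → b < N → h + h ≤ N → h ≤ t + s
  cyclic-gap a h t s meet refl a+h<N 2h≤N = ≮⇒≥ λ t+s<h → no-wrap t+s<h q (unwind t+s<h)
    where
    q : ℕ
    q = (s + (a + h)) / N

    unwind : t + s < h → s + h ≡ t + q * N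
    unwind t+s<h = +-cancelˡ-≡ a _ _ (begin
      a + (s + h)                 ≡⟨ x∙yz≈y∙xz +-commutativeSemigroup a s h ⟩
      s + (a + h)                 ≡⟨ m≡m%n+[m/n]*n (s + (a + h)) N ⟩
      (s + (a + h)) % N + q * N   ≡⟨ cong (_+ q * N) (trans (sym meet) (m<n⇒m%n≡m t+a<N)) ⟩
      t + a + q * N               ≡⟨ xy∙z≈y∙xz +-commutativeSemigroup t a (q * N) ⟩
      a + (t + q * N)             ∎)
      where
      open ≡-Reasoning
      t+a<N : t + a < N
      t+a<N = <-trans (+-monoˡ-< a (≤-<-trans (m≤m+n t s) t+s<h)) (subst (_< N) (+-comm a h) a+h<N)

    no-wrap : t + s < h → ∀ q′ → s + h ≡ t + q′ * N → ⊥
    no-wrap t+s<h zero s+h≡t =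
      <⇒≱ (≤-<-trans (m≤m+n t s) t+s<h)
          (≤-trans (m≤n+m h s) (≤-reflexive (trans s+h≡t (+-identityʳ t))))
    no-wrap t+s<h (suc q′) s+h≡t+N =
      <⇒≱ (<-≤-trans (+-monoˡ-< h (≤-<-trans (m≤n+m s t) t+s<h)) 2h≤N)
          (≤-trans (≤-trans (m≤m+n N (q′ * N)) (m≤n+m _ t)) (≤-reflexive (sym s+h≡t+N)))

data InAB : Layer → Set where
  A∈AB : InAB A
  B∈AB : InAB B

data InCD : Layer → Set where
  C∈CD : InCD C
  D∈CD : InCD D

layer-side : ∀ L → InAB L ⊎ InCD L
layer-side A = inj₁ A∈AB
layer-side B = inj₁ B∈AB
layer-side C = inj₂ C∈CD
layer-side D = inj₂ D∈CD

flip : Layer → Layer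
flip A = D
flip B = C
flip C = B
flip D = A

flip-AB : ∀ {L} → InAB L → InCD (flip L)
flip-AB A∈AB = D∈CD
flip-AB B∈AB = C∈CD

height : Layer → ℕ
height A = 0
height B = 1
height C = 3
height D = 4

height-injective : ∀ {L L′} → height L ≡ height L′ → L ≡ L′
height-injective {A} {A} refl = refl
height-injective {B} {B} refl = refl
height-injective {C} {C} refl = refl
height-injective {D} {D} refl = refl

_≟ᴸ_ : DecidableEquality Layer
L ≟ᴸ L′ = map′ height-injective (cong height) (height L ≟ height L′)

lag : Layer → ℕ
lag A = 1
lag B = 0
lag C = 0
lag D = 1

lag≤1 : ∀ L → lag L ≤ 1
lag≤1 A = s≤s z≤n
lag≤1 B = z≤n
lag≤1 C = z≤n
lag≤1 D = s≤s z≤n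

height-gap : ∀ {Lu Lx} → InCD Lu → InAB Lx → ∣ height Lu - height Lx ∣ ≡ 2 + (lag Lu + lag Lx)
height-gap C∈CD A∈AB = refl
height-gap C∈CD B∈AB = refl
height-gap D∈CD A∈AB = refl
height-gap D∈CD B∈AB = refl

ab-parity : ∀ m → Σ[ L ∈ Layer ] InAB L × Σ[ g ∈ ℕ ] m ≡ lag L + (g + g)
ab-parity zero = B , B∈AB , 0 , refl
ab-parity (suc m) with ab-parity m
... | _ , B∈AB , g , m≡2g   = A , A∈AB , g , cong suc m≡2g
... | _ , A∈AB , g , m≡1+2g = B , B∈AB , suc g , trans (cong suc m≡1+2g) (double-suc g)

module T (k : ℕ) where

  n : ℕ
  n = 2 + k

  V : Set
  V = TV n

  Adj : V → V → Set
  Adj = TAdj n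

  N : ℕ
  N = n + n

  open Cyclic N

  _≟ⱽ_ : DecidableEquality V
  _≟ⱽ_ = ≡-dec _≟ᴸ_ Fin._≟_

  pos : V → ℕ
  pos (A , i) = toℕ i + toℕ i
  pos (B , i) = suc (toℕ i + toℕ i)
  pos (C , i) = suc (toℕ i + toℕ i)
  pos (D , i) = toℕ i + toℕ i

  level : V → ℕ
  level (L , _) = height L

  pos-lag : ∀ L (i : Fin n) → pos (L , i) + lag L ≡ suc (toℕ i + toℕ i)
  pos-lag A i = +-comm _ 1
  pos-lag B i = +-identityʳ _
  pos-lag C i = +-identityʳ _
  pos-lag D i = +-comm _ 1

  pos<N : ∀ v → pos v < N
  pos<N (L , i) = ≤-<-trans (m≤m+n _ (lag L)) (subst (_< N) (sym (pos-lag L i)) 2i+1<N)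
    where
    2i+1<N : suc (toℕ i + toℕ i) < N
    2i+1<N = subst (_≤ N) (sym (double-suc (toℕ i))) (+-mono-≤ (toℕ<n i) (toℕ<n i))

  next-pos : ∀ c {i j} → Next n i j → (c + (2 + (toℕ i + toℕ i))) % N ≡ (c + (toℕ j + toℕ j)) % N
  next-pos c {i} {j} i→j = %-congˡ c {2 + (toℕ i + toℕ i)} {toℕ j + toℕ j} (step i→j)
    where
    step : Next n i j → (2 + (toℕ i + toℕ i)) % N ≡ (toℕ j + toℕ j) % N
    step (inj₁ 1+i≡j) =
      cong (_% N) (trans (double-suc (toℕ i)) (cong (λ m → m + m) 1+i≡j))
    step (inj₂ (1+i≡n , j≡0)) =
      trans (cong (_% N) (trans (double-suc (toℕ i)) (cong (λ m → m + m) 1+i≡n)))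
            (trans (n%n≡0 N) (cong (λ m → (m + m) % N) (sym j≡0)))

  -- T_n sits in (ℤ/N) × ℕ via (pos , level); Close r u w says that the cyclic distance of
  -- the positions plus the distance of the levels is at most r.
  data Close (r : ℕ) (u w : V) : Set where
    close : ∀ t s → t + s + ∣ level u - level w ∣ ≤ r → (t + pos u) % N ≡ (s + pos w) % N → Close r u w

  close-sym : ∀ {r u w} → Close r u w → Close r w u
  close-sym {u = u} {w} (close t s bound meet) =
    close s t (≤-trans (≤-reflexive (cong₂ _+_ (+-comm s t) (∣-∣-comm (level w) (level u)))) bound)
              (sym meet)

  close-trans : ∀ {r₁ r₂ u v w} → Close r₁ u v → Close r₂ v w → Close (r₁ + r₂) u w
  close-trans {r₁} {r₂} {u} {v} {w} (close t₁ s₁ bound₁ meet₁) (close t₂ s₂ bound₂ meet₂) =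
    close (t₂ + t₁) (s₁ + s₂) bound meet
    where
    rearrange : ∀ t₁ t₂ s₁ s₂ d₁ d₂ →
                t₂ + t₁ + (s₁ + s₂) + (d₁ + d₂) ≡ t₁ + s₁ + d₁ + (t₂ + s₂ + d₂)
    rearrange = solve-∀

    bound : t₂ + t₁ + (s₁ + s₂) + ∣ level u - level w ∣ ≤ r₁ + r₂
    bound = begin
      t₂ + t₁ + (s₁ + s₂) + ∣ level u - level w ∣
        ≤⟨ +-monoʳ-≤ (t₂ + t₁ + (s₁ + s₂)) (∣-∣-triangle (level u) (level v) (level w)) ⟩
      t₂ + t₁ + (s₁ + s₂) + (∣ level u - level v ∣ + ∣ level v - level w ∣)
        ≡⟨ rearrange t₁ t₂ s₁ s₂ _ _ ⟩
      t₁ + s₁ + ∣ level u - level v ∣ + (t₂ + s₂ + ∣ level v - level w ∣)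
        ≤⟨ +-mono-≤ bound₁ bound₂ ⟩
      r₁ + r₂ ∎
      where open ≤-Reasoning

    meet : (t₂ + t₁ + pos u) % N ≡ (s₁ + s₂ + pos w) % N
    meet = begin
      (t₂ + t₁ + pos u) % N     ≡⟨ cong (_% N) (+-assoc t₂ t₁ (pos u)) ⟩
      (t₂ + (t₁ + pos u)) % N   ≡⟨ %-congˡ t₂ meet₁ ⟩
      (t₂ + (s₁ + pos v)) % N   ≡⟨ cong (_% N) (x∙yz≈y∙xz +-commutativeSemigroup t₂ s₁ (pos v)) ⟩
      (s₁ + (t₂ + pos v)) % N   ≡⟨ %-congˡ s₁ meet₂ ⟩
      (s₁ + (s₂ + pos w)) % N   ≡⟨ cong (_% N) (+-assoc s₁ s₂ (pos w)) ⟨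
      (s₁ + s₂ + pos w) % N     ∎
      where open ≡-Reasoning

  edge-close : ∀ {u w} → TEdge n u w → Close 2 u w
  edge-close (aa i→j)  = close 2 0 ≤-refl (next-pos 0 i→j)
  edge-close (bb i→j)  = close 2 0 ≤-refl (next-pos 1 i→j)
  edge-close (cc i→j)  = close 2 0 ≤-refl (next-pos 1 i→j)
  edge-close (dd i→j)  = close 2 0 ≤-refl (next-pos 0 i→j)
  edge-close ab        = close 1 0 ≤-refl refl
  edge-close bc        = close 0 0 ≤-refl refl
  edge-close cd        = close 0 1 ≤-refl refl
  edge-close (a'b i→j) = close 0 1 ≤-refl (sym (next-pos 0 i→j))
  edge-close (cd' i→j) = close 1 0 ≤-refl (next-pos 0 i→j)

  walk-close : ∀ {u w m} → Walk Adj u w m → Close (m + m) u w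
  walk-close {u} nil = close 0 0 (≤-reflexive (∣n-n∣≡0 (level u))) refl
  walk-close {u} {w} {suc m} (cons e p) =
    subst (λ r → Close r u w) (double-suc m) (close-trans (adj-close e) (walk-close p))
    where
    adj-close : ∀ {u w} → Adj u w → Close 2 u w
    adj-close (inj₁ e) = edge-close e
    adj-close (inj₂ e) = close-sym (edge-close e)

  walk-length-≥ : ∀ {u w m} h → pos u + h ≡ pos w → h + h ≤ N → Walk Adj u w m →
                  h + ∣ level u - level w ∣ ≤ m + m
  walk-length-≥ {u} {w} h gap 2h≤N p with walk-close p
  ... | close t s bound meet = ≤-trans (+-monoˡ-≤ _ (cyclic-gap (pos u) h t s meet gap (pos<N w) 2h≤N)) bound

  dist-by-gap : ∀ {u w L} h → pos u + h ≡ pos w → h ≤ n → L + L ≡ h + ∣ level u - level w ∣ →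
                Walk Adj u w L → Dist Adj u w L
  dist-by-gap h gap h≤n 2L≡ p = dist-intro p λ q →
    m+m≤n+n⇒m≤n (≤-trans (≤-reflexive 2L≡) (walk-length-≥ h gap (+-mono-≤ h≤n h≤n) q))

  along : ∀ L {i j} → Next n i j → Adj (L , i) (L , j)
  along A i→j = inj₁ (aa i→j)
  along B i→j = inj₁ (bb i→j)
  along C i→j = inj₁ (cc i→j)
  along D i→j = inj₁ (dd i→j)

  split-last : ∀ {i k : Fin n} d → toℕ i + suc d ≡ toℕ k →
               Σ[ m ∈ Fin n ] toℕ i + d ≡ toℕ m × Next n m k
  split-last {i} {k} d i+d+1≡k =
    fromℕ< i+d<n , sym (toℕ-fromℕ< i+d<n) , inj₁ (trans (cong suc (toℕ-fromℕ< i+d<n)) 1+i+d≡k)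
    where
    1+i+d≡k : suc (toℕ i + d) ≡ toℕ k
    1+i+d≡k = trans (sym (+-suc (toℕ i) d)) i+d+1≡k

    i+d<n : toℕ i + d < n
    i+d<n = ≤-trans (≤-reflexive 1+i+d≡k) (<⇒≤ (toℕ<n k))

  run : ∀ L {i k : Fin n} d → toℕ i + d ≡ toℕ k → Walk Adj (L , i) (L , k) d
  run L {i} zero i+0≡k =
    subst (λ k → Walk Adj (L , i) (L , k) 0) (toℕ-injective (trans (sym (+-identityʳ (toℕ i))) i+0≡k)) nil
  run L (suc d) i+d+1≡k with split-last d i+d+1≡k
  ... | m , i+d≡m , m→k = snoc (run L d i+d≡m) (along L m→k)

  via-c : ∀ {L w m} {i : Fin n} → InCD L → Walk Adj (C , i) w m → Walk Adj (L , i) w (lag L + m)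
  via-c C∈CD p = p
  via-c D∈CD p = cons (inj₂ cd) p

  via-b : ∀ {L w m} {i : Fin n} → InAB L → Walk Adj (B , i) w m → Walk Adj (L , i) w (lag L + m)
  via-b B∈AB p = p
  via-b A∈AB p = cons (inj₁ ab) p

  descend-walk : ∀ {Lu Lx} {i k : Fin n} → InCD Lu → InAB Lx → ∀ g → toℕ i + (lag Lx + g) ≡ toℕ k →
                 Walk Adj (Lu , i) (Lx , k) (lag Lu + suc (lag Lx + g))
  descend-walk cu B∈AB g i+g≡k = via-c cu (cons (inj₂ bc) (run B g i+g≡k))
  descend-walk cu A∈AB g i+g+1≡k with split-last g i+g+1≡k
  ... | m , i+g≡m , m→k = via-c cu (cons (inj₂ bc) (snoc (run B g i+g≡m) (inj₂ (a'b m→k))))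

  ascend-walk : ∀ {Lx Lv} {k j : Fin n} → InAB Lx → InCD Lv → ∀ g → toℕ k + (lag Lv + g) ≡ toℕ j →
                Walk Adj (Lx , k) (Lv , j) (lag Lx + suc (lag Lv + g))
  ascend-walk ax C∈CD g k+g≡j = via-b ax (cons (inj₁ bc) (run C g k+g≡j))
  ascend-walk ax D∈CD g k+g+1≡j with split-last g k+g+1≡j
  ... | m , k+g≡m , m→j = via-b ax (cons (inj₁ bc) (snoc (run C g k+g≡m) (inj₁ (cd' m→j))))

  pos-advance : ∀ {L L′} {i k : Fin n} g → toℕ i + (lag L′ + g) ≡ toℕ k →
                pos (L , i) + (lag L + lag L′ + (g + g)) ≡ pos (L′ , k)
  pos-advance {L} {L′} {i} {k} g i→k = +-cancelʳ-≡ (lag L′) _ _ (begin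
    pos (L , i) + (lag L + lag L′ + (g + g)) + lag L′   ≡⟨ regroup (pos (L , i)) (lag L) (lag L′) g ⟩
    pos (L , i) + lag L + (δ + δ)                       ≡⟨ cong (_+ (δ + δ)) (pos-lag L i) ⟩
    suc (toℕ i + toℕ i) + (δ + δ)                       ≡⟨ cong suc (interleave (toℕ i) δ) ⟩
    suc ((toℕ i + δ) + (toℕ i + δ))                     ≡⟨ cong (λ m → suc (m + m)) i→k ⟩
    suc (toℕ k + toℕ k)                                 ≡⟨ pos-lag L′ k ⟨
    pos (L′ , k) + lag L′                               ∎)
    where
    open ≡-Reasoning
    δ : ℕ
    δ = lag L′ + g
    regroup : ∀ x p q g → x + (p + q + (g + g)) + q ≡ x + p + ((q + g) + (q + g))
    regroup = solve-∀
    interleave : ∀ x y → x + x + (y + y) ≡ (x + y) + (x + y)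
    interleave = solve-∀

  double-length : ∀ p q g → (p + suc (q + g)) + (p + suc (q + g)) ≡ (p + q + (g + g)) + (2 + (p + q))
  double-length = solve-∀

  dist-descend : ∀ {Lu Lx} {i k : Fin n} → InCD Lu → InAB Lx → ∀ g → toℕ i + (lag Lx + g) ≡ toℕ k →
                 lag Lu + lag Lx + (g + g) ≤ n → Dist Adj (Lu , i) (Lx , k) (lag Lu + suc (lag Lx + g))
  dist-descend {Lu} {Lx} cu ax g i→k bound =
    dist-by-gap _ (pos-advance {Lu} {Lx} g i→k) bound
      (trans (double-length (lag Lu) (lag Lx) g) (cong (lag Lu + lag Lx + (g + g) +_) (sym (height-gap cu ax))))
      (descend-walk cu ax g i→k)

  dist-ascend : ∀ {Lx Lv} {k j : Fin n} → InAB Lx → InCD Lv → ∀ g → toℕ k + (lag Lv + g) ≡ toℕ j →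
                lag Lx + lag Lv + (g + g) ≤ n → Dist Adj (Lv , j) (Lx , k) (lag Lx + suc (lag Lv + g))
  dist-ascend {Lx} {Lv} ax cv g k→j bound =
    dist-sym swap (dist-by-gap _ (pos-advance {Lx} {Lv} g k→j) bound
      (trans (double-length (lag Lx) (lag Lv) g) (cong (lag Lx + lag Lv + (g + g) +_) (sym height-gap′)))
      (ascend-walk ax cv g k→j))
    where
    height-gap′ : ∣ height Lx - height Lv ∣ ≡ 2 + (lag Lx + lag Lv)
    height-gap′ = trans (∣-∣-comm (height Lx) (height Lv))
                        (trans (height-gap cv ax) (cong (2 +_) (+-comm (lag Lv) (lag Lx))))

  mirror : V → V
  mirror (L , i) = flip L , i

  side : V → Fin n ⊎ Fin n
  side (A , i) = inj₁ i
  side (B , i) = inj₂ i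
  side (C , i) = inj₂ i
  side (D , i) = inj₁ i

  ab-vertex : Fin n ⊎ Fin n → V
  ab-vertex (inj₁ i) = A , i
  ab-vertex (inj₂ i) = B , i

  side-ab-vertex : ∀ s → side (ab-vertex s) ≡ s × side (mirror (ab-vertex s)) ≡ s
  side-ab-vertex (inj₁ i) = refl , refl
  side-ab-vertex (inj₂ i) = refl , refl

  pair-index : V → Fin (n + n)
  pair-index v = join n n (side v)

  ab-enum : Fin (n + n) → V
  ab-enum t = ab-vertex (splitAt n t)

  pair-index-ab-enum : ∀ t → pair-index (ab-enum t) ≡ t
  pair-index-ab-enum t = trans (cong (join n n) (proj₁ (side-ab-vertex (splitAt n t)))) (join-splitAt n n t)

  pair-index-mirror-ab-enum : ∀ t → pair-index (mirror (ab-enum t)) ≡ t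
  pair-index-mirror-ab-enum t = trans (cong (join n n) (proj₂ (side-ab-vertex (splitAt n t)))) (join-splitAt n n t)

  ab-enum-pair-index : ∀ {L} → InAB L → ∀ i → ab-enum (pair-index (L , i)) ≡ (L , i)
  ab-enum-pair-index A∈AB i = cong ab-vertex (splitAt-join n n (inj₁ i))
  ab-enum-pair-index B∈AB i = cong ab-vertex (splitAt-join n n (inj₂ i))

  abList : List V
  abList = map ab-enum (allFin (n + n))

  ab-member : ∀ {L} → InAB L → ∀ i → (L , i) ∈ abList
  ab-member {L} L∈AB i =
    subst (_∈ abList) (ab-enum-pair-index L∈AB i) (∈-map⁺ ab-enum (∈-allFin (pair-index (L , i))))

  abList-unique : Unique abList
  abList-unique = map⁺ ab-enum-injective (allFin⁺ (n + n))
    where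
    ab-enum-injective : ∀ {s t} → ab-enum s ≡ ab-enum t → s ≡ t
    ab-enum-injective {s} {t} eq =
      trans (sym (pair-index-ab-enum s)) (trans (cong pair-index eq) (pair-index-ab-enum t))

  abList-length : length abList ≡ n + n
  abList-length = trans (length-map ab-enum (allFin (n + n))) (length-tabulate id)

  Equalized : V → V → Set
  Equalized u v = ∃[ x ] (x ∈ abList × Equidistant Adj x u v)

  equalized-sym : ∀ {u v} → Equalized u v → Equalized v u
  equalized-sym (x , x∈ , k , du , dv) = x , x∈ , k , dv , du

  equalized-between : ∀ {Lu Lx Lv} {i j : Fin n} → InCD Lu → InAB Lx → InCD Lv → ∀ m g₁ g₂ →
                      lag Lu + g₁ ≡ lag Lv + g₂ → suc m ≡ lag Lx + g₁ + (lag Lv + g₂) →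
                      suc (toℕ i + m) ≡ toℕ j → Equalized (Lu , i) (Lv , j)
  equalized-between {Lu} {Lx} {Lv} {i} {j} cu ax cv m g₁ g₂ balanced 1+m≡span 1+i+m≡j =
    (Lx , x) , ab-member ax x , _ ,
    dist-descend cu ax g₁ i→x (proj₁ bounds) ,
    subst (Dist Adj (Lv , j) (Lx , x)) same-length (dist-ascend ax cv g₂ x→j (proj₂ bounds))
    where
    p q r : ℕ
    p = lag Lu
    q = lag Lx
    r = lag Lv

    i+span≡j : toℕ i + (q + g₁ + (r + g₂)) ≡ toℕ j
    i+span≡j = trans (cong (toℕ i +_) (sym 1+m≡span)) (trans (+-suc (toℕ i) m) 1+i+m≡j)

    bounds : p + q + (g₁ + g₁) ≤ n × q + r + (g₂ + g₂) ≤ n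
    bounds = balanced-halves-≤ {i = toℕ i} (lag≤1 Lu) balanced i+span≡j (toℕ<n j)

    i+q+g₁+r+g₂≡j : toℕ i + (q + g₁) + (r + g₂) ≡ toℕ j
    i+q+g₁+r+g₂≡j = trans (+-assoc (toℕ i) (q + g₁) (r + g₂)) i+span≡j

    x<n : toℕ i + (q + g₁) < n
    x<n = ≤-<-trans (≤-trans (m≤m+n _ (r + g₂)) (≤-reflexive i+q+g₁+r+g₂≡j)) (toℕ<n j)

    x : Fin n
    x = fromℕ< x<n

    i→x : toℕ i + (q + g₁) ≡ toℕ x
    i→x = sym (toℕ-fromℕ< x<n)

    x→j : toℕ x + (r + g₂) ≡ toℕ j
    x→j = trans (cong (_+ (r + g₂)) (toℕ-fromℕ< x<n)) i+q+g₁+r+g₂≡j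

    same-length : q + suc (r + g₂) ≡ p + suc (q + g₁)
    same-length = trans (cong (λ z → q + suc z) (sym balanced)) (swap-suc q p g₁)
      where
      swap-suc : ∀ q p g → q + suc (p + g) ≡ p + suc (q + g)
      swap-suc = solve-∀

  equalized-rung-next : ∀ {i j : Fin n} → toℕ i + 1 ≡ toℕ j → Equalized (C , i) (D , j)
  equalized-rung-next {i} {j} i+1≡j =
    (B , j) , ab-member B∈AB j , 2 ,
    dist-descend C∈CD B∈AB 1 i+1≡j (s≤s (s≤s z≤n)) ,
    dist-descend D∈CD B∈AB 0 (+-identityʳ (toℕ j)) (s≤s z≤n)

  next-irreflexive : ∀ {i} → ¬ Next n i i
  next-irreflexive (inj₁ 1+i≡i) = 1+n≢n 1+i≡i
  next-irreflexive (inj₂ (1+i≡n , i≡0)) with trans (cong suc (sym i≡0)) 1+i≡n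
  ... | ()

  predecessor : (i : Fin n) → Σ[ p ∈ Fin n ] Next n p i
  predecessor Fin.zero    = fromℕ (suc k) , inj₂ (cong suc (toℕ-fromℕ (suc k)) , refl)
  predecessor (Fin.suc i) = inject₁ i , inj₁ (cong suc (toℕ-inject₁ i))

  c-to-previous-b-≥2 : ∀ {p i m} → Next n p i → Walk Adj (C , i) (B , p) m → 2 ≤ m
  c-to-previous-b-≥2 p→i (cons (inj₁ ()) nil)
  c-to-previous-b-≥2 p→i (cons (inj₂ bc) nil) = ⊥-elim (next-irreflexive p→i)
  c-to-previous-b-≥2 p→i (cons _ (cons _ _)) = s≤s (s≤s z≤n)

  d-to-b-≥2 : ∀ {p i m} → Walk Adj (D , i) (B , p) m → 2 ≤ m
  d-to-b-≥2 (cons (inj₁ ()) nil)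
  d-to-b-≥2 (cons (inj₂ ()) nil)
  d-to-b-≥2 (cons _ (cons _ _)) = s≤s (s≤s z≤n)

  -- p is i - 1 cyclically, so for i = 0 the linear gap bounds do not apply.
  equalized-rung : (i : Fin n) → Equalized (C , i) (D , i)
  equalized-rung i with predecessor i
  ... | p , p→i =
    (B , p) , ab-member B∈AB p , 2 ,
    dist-intro (cons (inj₂ (cc p→i)) (cons (inj₂ bc) nil)) (c-to-previous-b-≥2 p→i) ,
    dist-intro (cons (inj₂ (cd' p→i)) (cons (inj₂ bc) nil)) d-to-b-≥2

  equalized-ahead : ∀ {Lu Lv} {i j : Fin n} → InCD Lu → InCD Lv → ∀ m → suc (toℕ i + m) ≡ toℕ j →
                    Equalized (Lu , i) (Lv , j)
  equalized-ahead C∈CD C∈CD m i<j with ab-parity (suc m)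
  ... | _ , ax , g , 1+m≡ =
    equalized-between C∈CD ax C∈CD m g g refl (trans 1+m≡ (sym (+-assoc _ g g))) i<j
  equalized-ahead D∈CD D∈CD m i<j with ab-parity m
  ... | _ , ax , g , m≡ =
    equalized-between D∈CD ax D∈CD m g g refl (trans (cong suc m≡) (odd-halves _ g)) i<j
  equalized-ahead D∈CD C∈CD m i<j with ab-parity m
  ... | _ , ax , g , m≡ =
    equalized-between D∈CD ax C∈CD m g (suc g) refl (trans (cong suc m≡) (odd-halves _ g)) i<j
  equalized-ahead C∈CD D∈CD zero i<j = equalized-rung-next (trans (+-suc _ 0) i<j)
  equalized-ahead C∈CD D∈CD (suc m) i<j with ab-parity m
  ... | _ , ax , g , m≡ =
    equalized-between C∈CD ax D∈CD (suc m) (suc g) g refl (trans (cong (suc ∘ suc) m≡) (even-halves _ g)) i<j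

  equalized-same-index : ∀ {Lu Lv} {i : Fin n} → InCD Lu → InCD Lv → (Lu , i) ≢ (Lv , i) →
                         Equalized (Lu , i) (Lv , i)
  equalized-same-index C∈CD C∈CD u≢v = ⊥-elim (u≢v refl)
  equalized-same-index C∈CD D∈CD _   = equalized-rung _
  equalized-same-index D∈CD C∈CD _   = equalized-sym (equalized-rung _)
  equalized-same-index D∈CD D∈CD u≢v = ⊥-elim (u≢v refl)

  equalized-CD : ∀ {Lu Lv} {i j : Fin n} → InCD Lu → InCD Lv → (Lu , i) ≢ (Lv , j) →
                 Equalized (Lu , i) (Lv , j)
  equalized-CD {i = i} {j} cu cv u≢v with <-cmp (toℕ i) (toℕ j)
  ... | tri< i<j _ _ = equalized-ahead cu cv _ (proj₂ (m≤n⇒∃[o]m+o≡n i<j))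
  ... | tri> _ _ j<i = equalized-sym (equalized-ahead cv cu _ (proj₂ (m≤n⇒∃[o]m+o≡n j<i)))
  ... | tri≈ _ i≡j _ with toℕ-injective i≡j
  ...   | refl = equalized-same-index cu cv u≢v

  abList-equalizer : IsDistanceEqualizer Adj abList
  abList-equalizer (Lu , i) (Lv , j) u≢v u∉ v∉ = equalized-CD (outside u∉) (outside v∉) u≢v
    where
    outside : ∀ {L i} → (L , i) ∉ abList → InCD L
    outside {L} {i} ∉ab with layer-side L
    ... | inj₁ L∈AB = ⊥-elim (∉ab (ab-member L∈AB i))
    ... | inj₂ L∈CD = L∈CD

  mirror-edge : ∀ {u w} → TEdge n u w → Adj (mirror u) (mirror w)
  mirror-edge (aa i→j)  = inj₁ (dd i→j)
  mirror-edge (bb i→j)  = inj₁ (cc i→j)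
  mirror-edge (cc i→j)  = inj₁ (bb i→j)
  mirror-edge (dd i→j)  = inj₁ (aa i→j)
  mirror-edge ab        = inj₂ cd
  mirror-edge bc        = inj₂ bc
  mirror-edge cd        = inj₂ ab
  mirror-edge (a'b i→j) = inj₂ (cd' i→j)
  mirror-edge (cd' i→j) = inj₂ (a'b i→j)

  mirror-adj : ∀ {u w} → Adj u w → Adj (mirror u) (mirror w)
  mirror-adj (inj₁ e) = mirror-edge e
  mirror-adj (inj₂ e) = swap (mirror-edge e)

  mirror-involutive : ∀ v → mirror (mirror v) ≡ v
  mirror-involutive (A , i) = refl
  mirror-involutive (B , i) = refl
  mirror-involutive (C , i) = refl
  mirror-involutive (D , i) = refl

  rung : ∀ {Lu Ly} {i y : Fin n} → InCD Lu → InAB Ly → Adj (Lu , i) (Ly , y) → (Ly , y) ≡ mirror (Lu , i)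
  rung C∈CD B∈AB (inj₂ bc) = refl
  rung C∈CD A∈AB (inj₁ ())
  rung C∈CD B∈AB (inj₁ ())
  rung D∈CD A∈AB (inj₁ ())
  rung D∈CD B∈AB (inj₁ ())

  -- Up to its first rung the walk stays on the c/d side, where mirroring is an isomorphism
  -- onto the a/b side; the mirrored prefix ends where the rung does, and the rung is saved.
  shortcut : ∀ {Lu Lw} {i j : Fin n} {m} → InCD Lu → InAB Lw → Walk Adj (Lu , i) (Lw , j) m →
             Σ[ m′ ∈ ℕ ] m′ < m × Walk Adj (mirror (Lu , i)) (Lw , j) m′
  shortcut C∈CD () nil
  shortcut D∈CD () nil
  shortcut cu aw (cons {w = Ly , y} e p) with layer-side Ly
  ... | inj₁ ay = _ , ≤-refl , subst (λ v → Walk Adj v _ _) (rung cu ay e) p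
  ... | inj₂ cy with shortcut cy aw p
  ...   | m′ , m′<m , q = suc m′ , s≤s m′<m , cons (mirror-adj e) q

  mirror-unequalizable : ∀ {L} (i : Fin n) → InAB L → Unequalizable Adj (L , i) (mirror (L , i))
  mirror-unequalizable {L} i L∈AB = distinct L∈AB , no-equidistant
    where
    distinct : InAB L → (L , i) ≢ mirror (L , i)
    distinct A∈AB ()
    distinct B∈AB ()

    no-equidistant : ∀ x → ¬ Equidistant Adj x (L , i) (mirror (L , i))
    no-equidistant (Lx , j) (k , (p₁ , shortest₁) , (p₂ , shortest₂)) with layer-side Lx
    ... | inj₁ x∈AB with shortcut (flip-AB L∈AB) x∈AB p₂
    ...   | m , m<k , q = shortest₁ m m<k (subst (λ v → Walk Adj v (Lx , j) m) (mirror-involutive (L , i)) q)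
    no-equidistant (Lx , j) (k , (p₁ , shortest₁) , (p₂ , shortest₂)) | inj₂ x∈CD
      with shortcut x∈CD L∈AB (reverse swap p₁)
    ... | m , m<k , q =
      shortest₂ m m<k (reverse swap (subst (λ v → Walk Adj v (mirror (L , i)) m)
                                           (mirror-involutive (Lx , j))
                                           (map-walk mirror mirror-adj q)))

  abList-minimum : ∀ S → IsDistanceEqualizer Adj S → n + n ≤ length S
  abList-minimum S =
    unequalizable-pairs≤length _≟ⱽ_ ab-enum (mirror ∘ ab-enum) pair-index
      pair-index-ab-enum pair-index-mirror-ab-enum (λ t → pair-unequalizable (splitAt n t))
    where
    pair-unequalizable : ∀ s → Unequalizable Adj (ab-vertex s) (mirror (ab-vertex s))
    pair-unequalizable (inj₁ i) = mirror-unequalizable i A∈AB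
    pair-unequalizable (inj₂ i) = mirror-unequalizable i B∈AB

  eqdim : EqDimIs Adj (n + n)
  eqdim = (abList , abList-unique , abList-length , abList-equalizer) , λ S _ → abList-minimum S

eqdim-T : ∀ n → 2 ≤ n → EqDimIs (TAdj n) (2 * n)
eqdim-T (suc (suc k)) _ = subst (EqDimIs (TAdj n)) (cong (n +_) (sym (+-identityʳ n))) (T.eqdim k)
  where
  n : ℕ
  n = 2 + k
eqdim-T (suc zero) (s≤s ())

mainTheorem6 : ∀ (n : ℕ) → 5 ≤ n → EqDimIs (TAdj n) (2 * n)
mainTheorem6 n 5≤n = eqdim-T n (≤-trans (s≤s (s≤s z≤n)) 5≤n)
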